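{- Let $G$ be a connected $\{K_{1,3},Z_{2},N\}$-free graph which contains an induced subgraph $H=H_{3}(\{C_{u_{6}}\})$, where $C_{u_{6}}$ is a nonempty clique. Then for each vertex $a\in V(G)\setminus V(H)$ with $N_{G}(a)\cap V(H)\neq\emptyset$, one of the following holds: (i) $G[V(H)\cup\{a\}]\in\mathcal{H}_{3}$; (ii) $N_{G}(a)\cap V(H)=\{u_{1},u_{i},u_{7-i}\}$ for some $i\in\{2,3\}$ and $|C_{u_{6}}|=1$ (and so $G[V(H)\cup\{a\}]\in\mathcal{H}_{6}$); (iii) $N_{G}(a)\cap V(H)=\{u_{4},u_{5}\}$ (and so $G[V(H)\cup\{a\}]\in\mathcal{H}_{5}$).
   Context: All graphs are finite and simple; $N_G(a)$ is the neighborhood of $a$, $G[X]$ the induced subgraph. $\mathcal{F}$-free means no member of $\mathcal{F}$ is an induced subgraph. $K_{1,3}$ is the star with three leaves; $Z_2$ is a triangle $abc$ plus a path $ade$ on new vertices $d,e$; $N$ is a triangle with one new pendant vertex attached to each of its three vertices. Expansion: for a graph $H$, expandable set $U\subseteq V(H)$, and pairwise disjoint nonempty cliques $\mathcal{C}=\{C_a\mid a\in U\}$, $H(\mathcal{C})$ replaces each $a\in U$ by the clique $C_a$: a vertex of $C_a$ is adjacent to $u\in V(H)\setminus U$ iff $au\in E(H)$; for distinct $a,b\in U$, $C_a$ is completely joined to $C_b$ if $ab\in E(H)$ and has no edges to it otherwise; other adjacencies as in $H$. $H_3$: vertices $u_1,\dots,u_6$, edges $u_1u_2,u_1u_3,u_2u_4,u_3u_5,u_6u_2,u_6u_3,u_6u_4,u_6u_5$;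 $U_3=\{u_6\}$. So $H_3(\{C_{u_6}\})$ has vertices $u_1,\dots,u_5$ and the clique $C_{u_6}$ completely joined to $u_2,u_3,u_4,u_5$. $H_5$: vertices $w_1,\dots,w_7$, edges $w_1w_3,w_1w_5,w_3w_4,w_5w_6,w_2w_4,w_2w_6,w_7w_3,w_7w_4,w_7w_5,w_7w_6$; $U_5=\{w_7\}$. $H_6$: vertices $x_1,\dots,x_7$, edges $x_1x_2,x_1x_3,x_1x_5,x_3x_5,x_3x_4,x_2x_4,x_2x_6,x_4x_6,x_5x_6,x_5x_7,x_6x_7$. For $i\in\{3,5\}$, $\mathcal{H}_i$ is the family of graphs isomorphic to some $H_i(\mathcal{C})$ with $\mathcal{C}=\{C_a\mid a\in U_i\}$ pairwise disjoint nonempty cliques; $\mathcal{H}_6=\{H_6\}$ (up to isomorphism). -}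

module Defs where

open import Data.Nat using (ℕ; zero; suc; _+_; _∸_)
open import Data.Nat.Properties using () renaming (_≟_ to _≟ℕ_)
open import Data.Bool using (Bool; true; false; _∧_; _∨_; not)
open import Data.Bool.Properties using (∨-comm)
open import Data.Fin using (Fin; toℕ; splitAt; inject₁; fromℕ; _≟_)

open import Data.List using (List; []; _∷_; any)
open import Data.Product using (Σ; ∃; _×_; _,_; proj₁)
open import Data.Sum using (_⊎_; inj₁; inj₂)
open import Relation.Nullary using (¬_; yes; no)
open import Relation.Nullary.Decidable using (⌊_⌋)
open import Relation.Binary.PropositionalEquality using (_≡_; refl; sym; cong₂)
open import Function.Definitions using (Injective)

record Graph (n : ℕ) : Set where
  field
    adj    : Fin n → Fin n → Bool
    adj-sym    : ∀ x y → adj x y ≡ adj y x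
    adj-irrefl : ∀ x → adj x x ≡ false
open Graph public

private
  eqb : ∀ {n} → Fin n → Fin n → Bool
  eqb x y = ⌊ x ≟ y ⌋

  eqb-sym : ∀ {n} (x y : Fin n) → eqb x y ≡ eqb y x
  eqb-sym x y with x ≟ y | y ≟ x
  ... | yes _ | yes _ = refl
  ... | no _  | no _  = refl
  ... | yes p | no q  = Data.Empty.⊥-elim (q (sym p)) where import Data.Empty
  ... | no p  | yes q = Data.Empty.⊥-elim (p (sym q)) where import Data.Empty

  eqb-refl : ∀ {n} (x : Fin n) → eqb x x ≡ true
  eqb-refl x with x ≟ x
  ... | yes _ = refl
  ... | no p  = Data.Empty.⊥-elim (p refl) where import Data.Empty

mkGraph : ∀ {n} → (Fin n → Fin n → Bool) → Graph n
mkGraph {n} r = record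
  { adj = λ x y → not (eqb x y) ∧ (r x y ∨ r y x)
  ; adj-sym    = λ x y → cong₂ (λ a b → not a ∧ b) (eqb-sym x y) (∨-comm (r x y) (r y x))
  ; adj-irrefl = λ x → helper x
  }
  where
  helper : ∀ x → not (eqb x x) ∧ (r x x ∨ r x x) ≡ false
  helper x with eqb x x | eqb-refl x
  ... | .true | refl = refl

edgeIn : List (ℕ × ℕ) → ℕ → ℕ → Bool
edgeIn []             i j = false
edgeIn ((a , b) ∷ es) i j = (⌊ a ≟ℕ i ⌋ ∧ ⌊ b ≟ℕ j ⌋) ∨ edgeIn es i j

fromEdges : (n : ℕ) → List (ℕ × ℕ) → Graph n
fromEdges n es = mkGraph (λ x y → edgeIn es (toℕ x) (toℕ y))

Embeds : ∀ {k n} → Graph k → Graph n → Set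
Embeds {k} {n} H G =
  Σ (Fin k → Fin n) λ f →
    Injective _≡_ _≡_ f × (∀ x y → adj G (f x) (f y) ≡ adj H x y)

Free : ∀ {k n} → Graph k → Graph n → Set
Free H G = ¬ Embeds H G

data Reachable {n} (G : Graph n) : Fin n → Fin n → Set where
  here : ∀ {x} → Reachable G x x
  step : ∀ {x y z} → adj G x y ≡ true → Reachable G y z → Reachable G x z

Connected : ∀ {n} → Graph n → Set
Connected G = ∀ x y → Reachable G x y

-- The induced subgraph G[S] (S given as a predicate on vertices) is
-- isomorphic to H: there is an induced embedding of H whose image is S.
InducesCopy : ∀ {k n} → Graph k → (G : Graph n) → (Fin n → Set) → Set
InducesCopy {k} H G S =
  Σ (Embeds H G) λ φ →
    (∀ x → S (proj₁ φ x)) × (∀ v → S v → ∃ λ x → proj₁ φ x ≡ v)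

-- Named small graphs (vertex i of the paper is numbered i-1).

K13 : Graph 4
K13 = fromEdges 4 ((0 , 1) ∷ (0 , 2) ∷ (0 , 3) ∷ [])

Z2 : Graph 5
Z2 = fromEdges 5 ((0 , 1) ∷ (1 , 2) ∷ (0 , 2) ∷ (0 , 3) ∷ (3 , 4) ∷ [])

Net : Graph 6
Net = fromEdges 6 ((0 , 1) ∷ (1 , 2) ∷ (0 , 2) ∷ (0 , 3) ∷ (1 , 4) ∷ (2 , 5) ∷ [])

-- H_3 on u_1..u_6 (u_i = i-1); expandable vertex u_6 = 5 (the last one).
H3 : Graph 6
H3 = fromEdges 6 ((0 , 1) ∷ (0 , 2) ∷ (1 , 3) ∷ (2 , 4) ∷
                  (5 , 1) ∷ (5 , 2) ∷ (5 , 3) ∷ (5 , 4) ∷ [])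

-- H_5 on w_1..w_7 (w_i = i-1); expandable vertex w_7 = 6 (the last one).
H5 : Graph 7
H5 = fromEdges 7 ((0 , 2) ∷ (0 , 4) ∷ (2 , 3) ∷ (4 , 5) ∷ (1 , 3) ∷
                  (1 , 5) ∷ (6 , 2) ∷ (6 , 3) ∷ (6 , 4) ∷ (6 , 5) ∷ [])

H6 : Graph 7
H6 = fromEdges 7 ((0 , 1) ∷ (0 , 2) ∷ (0 , 4) ∷ (2 , 4) ∷ (2 , 3) ∷ (1 , 3) ∷
                  (1 , 5) ∷ (3 , 5) ∷ (4 , 5) ∷ (4 , 6) ∷ (5 , 6) ∷ [])

-- Vertices of H(C): Fin (n + suc m), where
-- the first n are the unexpanded vertices of H (same numbering) and the
-- last suc m form the clique C.

code : ∀ {n m} → Fin (n + suc m) → Fin (suc n)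
code {n} x with splitAt n x
... | inj₁ i = inject₁ i
... | inj₂ _ = fromℕ n

inClique : ∀ {n m} → Fin (n + suc m) → Bool
inClique {n} x with splitAt n x
... | inj₁ _ = false
... | inj₂ _ = true

expandLast : ∀ {n} → Graph (suc n) → (m : ℕ) → Graph (n + suc m)
expandLast H m = mkGraph (λ x y → (inClique x ∧ inClique y) ∨ adj H (code x) (code y))

-- H_3({C_{u_6}}) with |C_{u_6}| = suc m; vertices u_1..u_5 are 0..4.
H3exp : (m : ℕ) → Graph (5 + suc m)
H3exp m = expandLast H3 m

H5exp : (m : ℕ) → Graph (6 + suc m)
H5exp m = expandLast H5 m

ImgPlus : ∀ {k n} → (Fin k → Fin n) → Fin n → Fin n → Set
ImgPlus f a v = (∃ λ x → f x ≡ v) ⊎ v ≡ a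

In𝓗3 : ∀ {n} → Graph n → (Fin n → Set) → Set
In𝓗3 G S = ∃ λ m → InducesCopy (H3exp m) G S

In𝓗5 : ∀ {n} → Graph n → (Fin n → Set) → Set
In𝓗5 G S = ∃ λ m → InducesCopy (H5exp m) G S

In𝓗6 : ∀ {n} → Graph n → (Fin n → Set) → Set
In𝓗6 G S = InducesCopy H6 G S

NbrInImgIs : ∀ {k n} (G : Graph n) → (Fin k → Fin n) → Fin n → (Fin k → Set) → Set
NbrInImgIs G f a P = ∀ x → (adj G a (f x) ≡ true → P x) × (P x → adj G a (f x) ≡ true)

-- x is the vertex u_j of H_3(C) (1 ≤ j ≤ 5), i.e. x has number j-1.
IsU : ∀ {k} → ℕ → Fin k → Set
IsU j x = toℕ x ≡ j ∸ 1

module Submission where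

-- A vertex a outside H = H₃(C) sees, together with u₁, …, u₅ and any one vertex c of C,
-- a seven-vertex graph; evaluating all 64 possible neighbourhoods of a shows that, unless
-- it contains a claw or a Z₂, a is adjacent to exactly {u₂,u₃,u₄,u₅,c}, {u₄,u₅},
-- {u₁,u₂,u₅}, {u₁,u₃,u₄} or nothing.  The answer on u₁, …, u₅ does not depend on c, so a
-- treats all of C alike; with two vertices of C, the cases {u₁,u₂,u₅} and {u₁,u₃,u₄}
-- contain a Z₂.
-- Since H is a blow-up of H₃ in which C is the class of u₆ and a is uniform on every
-- class, G[V(H) ∪ {a}] is a blow-up of H₃ plus one vertex, which in the three
-- non-trivial cases is a relabelling of H₃(C ∪ {a}), H₆ or H₅(C).

open import Defs
open import Data.Nat using (ℕ; zero; suc; _+_; _∸_)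
open import Data.Fin using (Fin; zero; suc; _≟_; splitAt; join; fromℕ; inject₁; lift)
open import Data.Fin.Properties
  using (all?; suc-injective; splitAt-join; join-splitAt; fromℕ≢inject₁; inject₁-injective)
open import Data.Bool using (Bool; true; false; not; T; _∧_; _∨_)
import Data.Bool as Bool
open import Data.Bool.Properties using (T-∧; ∨-idem)
open import Data.Vec using (Vec; []; _∷_; lookup; tabulate; init)
open import Data.Vec.Properties using (lookup∘tabulate; lookup-replicate)
import Data.Vec.Properties as Vec
open import Data.List using (List; []; _∷_)
open import Data.Maybe using (Maybe; just; nothing; is-just; _<∣>_)
import Data.Maybe as Maybe
open import Data.Product using (∃; _×_; _,_; proj₁; proj₂)
open import Data.Sum using (_⊎_; inj₁; inj₂; [_,_]′)
import Data.Sum as Sum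
open import Data.Sum.Properties using (inj₂-injective)
open import Data.Empty using (⊥; ⊥-elim)
open import Function using (_∘_; const; id; case_of_; Equivalence)
open import Function.Definitions using (Injective; StrictlySurjective)
open import Relation.Nullary using (¬_; Dec; yes; no; _×-dec_; _→-dec_; contradiction)
open import Relation.Nullary.Decidable using (⌊_⌋; ⌊⌋-map′; True; toWitness; decidable-stable)
import Relation.Nullary.Decidable as Dec
open import Relation.Binary.PropositionalEquality

private
  variable
    c d k l m n : ℕ

Embeds-trans : {F : Graph k} {H : Graph l} {G : Graph n} →
  Embeds F H → Embeds H G → Embeds F G
Embeds-trans (f , f-inj , f-adj) (g , g-inj , g-adj) =
  g ∘ f , f-inj ∘ g-inj , λ x y → trans (g-adj (f x) (f y)) (f-adj x y)

record _≅_ (S : Graph k) (T : Graph l) : Set where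
  constructor iso
  field
    embedding : Embeds S T
    onto      : StrictlySurjective _≡_ (proj₁ embedding)

InducesCopy-resp-≅ : {G : Graph n} {S : Graph k} {T : Graph l} {X : Fin n → Set} →
  S ≅ T → InducesCopy S G X → InducesCopy T G X
InducesCopy-resp-≅ {S = S} {T} {X} (iso (σ , σ-inj , σ-adj) σ-onto) ((ι , ι-inj , ι-adj) , ι-img , ι-onto) =
  (ι ∘ σ⁻¹ , σ⁻¹-inj ∘ ι-inj , λ x y → trans (ι-adj (σ⁻¹ x) (σ⁻¹ y)) (σ⁻¹-adj x y)) ,
  ι-img ∘ σ⁻¹ , onto
  where
  σ⁻¹ : _ → _
  σ⁻¹ y = proj₁ (σ-onto y)

  σσ⁻¹ : ∀ y → σ (σ⁻¹ y) ≡ y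
  σσ⁻¹ y = proj₂ (σ-onto y)

  σ⁻¹-inj : Injective _≡_ _≡_ σ⁻¹
  σ⁻¹-inj {x} {y} e = trans (sym (σσ⁻¹ x)) (trans (cong σ e) (σσ⁻¹ y))

  σ⁻¹-adj : ∀ x y → adj S (σ⁻¹ x) (σ⁻¹ y) ≡ adj T x y
  σ⁻¹-adj x y = trans (sym (σ-adj (σ⁻¹ x) (σ⁻¹ y))) (cong₂ (adj T) (σσ⁻¹ x) (σσ⁻¹ y))

  onto : ∀ v → X v → ∃ λ x → ι (σ⁻¹ x) ≡ v
  onto v v∈X with ι-onto v v∈X
  ... | s , refl = σ s , cong ι (σ-inj (σσ⁻¹ (σ s)))

extend : Graph k → (Fin k → Bool) → Graph (suc k)
extend {k} H b = record { adj = adj⁺ ; adj-sym = sym⁺ ; adj-irrefl = irrefl⁺ }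
  where
  adj⁺ : Fin (suc k) → Fin (suc k) → Bool
  adj⁺ zero    zero    = false
  adj⁺ zero    (suc y) = b y
  adj⁺ (suc x) zero    = b x
  adj⁺ (suc x) (suc y) = adj H x y

  sym⁺ : ∀ x y → adj⁺ x y ≡ adj⁺ y x
  sym⁺ zero    zero    = refl
  sym⁺ zero    (suc y) = refl
  sym⁺ (suc x) zero    = refl
  sym⁺ (suc x) (suc y) = adj-sym H x y

  irrefl⁺ : ∀ x → adj⁺ x x ≡ false
  irrefl⁺ zero    = refl
  irrefl⁺ (suc x) = adj-irrefl H x

extend-cong : {S : Graph k} {b b′ : Fin k → Bool} →
  (∀ x → b x ≡ b′ x) → Embeds (extend S b) (extend S b′)
extend-cong {S = S} b≗b′ = id , id , adj-id
  where
  adj-id : ∀ x y → adj (extend S _) x y ≡ adj (extend S _) x y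
  adj-id zero    zero    = refl
  adj-id zero    (suc y) = sym (b≗b′ y)
  adj-id (suc x) zero    = sym (b≗b′ x)
  adj-id (suc x) (suc y) = refl

adjoin : {G : Graph n} {H : Graph k} (φ : Embeds H G) (a : Fin n) →
  ¬ (∃ λ x → proj₁ φ x ≡ a) →
  InducesCopy (extend H (λ x → adj G a (proj₁ φ x))) G (ImgPlus (proj₁ φ) a)
adjoin {G = G} (φ , φ-inj , φ-adj) a a∉φ = (ι , ι-inj , ι-adj) , ι-img , ι-onto
  where
  ι : Fin _ → Fin _
  ι zero    = a
  ι (suc x) = φ x

  ι-inj : Injective _≡_ _≡_ ι
  ι-inj {zero}  {zero}  _ = refl
  ι-inj {zero}  {suc y} e = ⊥-elim (a∉φ (y , sym e))
  ι-inj {suc x} {zero}  e = ⊥-elim (a∉φ (x , e))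
  ι-inj {suc x} {suc y} e = cong suc (φ-inj e)

  ι-adj : ∀ x y → adj G (ι x) (ι y) ≡ adj (extend _ _) x y
  ι-adj zero    zero    = adj-irrefl G a
  ι-adj zero    (suc y) = refl
  ι-adj (suc x) zero    = adj-sym G (φ x) a
  ι-adj (suc x) (suc y) = φ-adj x y

  ι-img : ∀ x → ImgPlus φ a (ι x)
  ι-img zero    = inj₂ refl
  ι-img (suc x) = inj₁ (x , refl)

  ι-onto : ∀ v → ImgPlus φ a v → ∃ λ x → ι x ≡ v
  ι-onto v (inj₁ (x , refl)) = suc x , refl
  ι-onto v (inj₂ refl)       = zero , refl

-- Deciding facts about small graphs by evaluation

IsInduced : Graph k → Graph l → (Fin k → Fin l) → Set
IsInduced F H h = Injective _≡_ _≡_ h × (∀ x y → adj H (h x) (h y) ≡ adj F x y)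

isInduced? : (F : Graph k) (H : Graph l) (h : Fin k → Fin l) → Dec (IsInduced F H h)
isInduced? F H h = injective? ×-dec all? λ x → all? λ y → adj H (h x) (h y) Bool.≟ adj F x y
  where
  injective? : Dec (Injective _≡_ _≡_ h)
  injective? = Dec.map′ (λ p {x} {y} → p x y) (λ p x y → p)
    (all? λ x → all? λ y → h x ≟ h y →-dec x ≟ y)

findEmbedding : (F : Graph k) (H : Graph l) → List (Vec (Fin l) k) → Maybe (Embeds F H)
findEmbedding F H [] = nothing
findEmbedding F H (h ∷ hs) with isInduced? F H (lookup h)
... | yes p = just (lookup h , p)
... | no _  = findEmbedding F H hs

allVecs : ∀ k → (Vec Bool k → Bool) → Bool
allVecs zero    g = g []
allVecs (suc k) g = allVecs k (g ∘ (false ∷_)) ∧ allVecs k (g ∘ (true ∷_))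

allVecs-sound : ∀ k g → T (allVecs k g) → ∀ v → T (g v)
allVecs-sound zero    g t [] = t
allVecs-sound (suc k) g t (false ∷ v) = allVecs-sound k _ (proj₁ (Equivalence.to T-∧ t)) v
allVecs-sound (suc k) g t (true  ∷ v) = allVecs-sound k _ (proj₂ (Equivalence.to T-∧ t)) v

allVecs-just : ∀ k {P : Vec Bool k → Set} (f : ∀ v → Maybe (P v)) →
  T (allVecs k (is-just ∘ f)) → ∀ v → P v
allVecs-just k f t v with f v | allVecs-sound k (is-just ∘ f) t v
... | just p | _ = p

-- Blow-ups

⌊≟⌋-≢ : {x y : Fin n} → x ≢ y → ⌊ x ≟ y ⌋ ≡ false
⌊≟⌋-≢ {x = x} {y} x≢y with x ≟ y
... | yes x≡y = ⊥-elim (x≢y x≡y)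
... | no _    = refl

⌊≟⌋-refl : (x : Fin n) → ⌊ x ≟ x ⌋ ≡ true
⌊≟⌋-refl x with x ≟ x
... | yes _  = refl
... | no x≢x = ⊥-elim (x≢x refl)

reflAdj : Graph k → Fin k → Fin k → Bool
reflAdj P u v = ⌊ u ≟ v ⌋ ∨ adj P u v

record IsBlowUp (S : Graph k) (κ : Fin k → Fin c) (P : Graph c) : Set where
  constructor blowUp
  field adj-blowUp : ∀ {x y} → x ≢ y → adj S x y ≡ reflAdj P (κ x) (κ y)

blowUp-embeds : {S : Graph k} {T : Graph l} {P : Graph c} {Q : Graph d}
  {κ : Fin k → Fin c} {μ : Fin l → Fin d} → IsBlowUp S κ P → IsBlowUp T μ Q →
  (σ : Fin k → Fin l) → Injective _≡_ _≡_ σ →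
  (τ : Fin c → Fin d) → (∀ x → μ (σ x) ≡ τ (κ x)) →
  (∀ u v → reflAdj Q (τ u) (τ v) ≡ reflAdj P u v) →
  Embeds S T
blowUp-embeds {S = S} {T} {P} {Q} {κ} {μ} (blowUp S-blowUp) (blowUp T-blowUp) σ σ-inj τ μσ≡τκ τ-pattern =
  σ , σ-inj , σ-adj
  where
  σ-adj : ∀ x y → adj T (σ x) (σ y) ≡ adj S x y
  σ-adj x y with x ≟ y
  ... | yes refl = trans (adj-irrefl T (σ x)) (sym (adj-irrefl S x))
  ... | no x≢y = begin
    adj T (σ x) (σ y)                   ≡⟨ T-blowUp (x≢y ∘ σ-inj) ⟩
    reflAdj Q (μ (σ x)) (μ (σ y))       ≡⟨ cong₂ (reflAdj Q) (μσ≡τκ x) (μσ≡τκ y) ⟩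
    reflAdj Q (τ (κ x)) (τ (κ y))       ≡⟨ τ-pattern (κ x) (κ y) ⟩
    reflAdj P (κ x) (κ y)               ≡⟨ sym (S-blowUp x≢y) ⟩
    adj S x y                           ∎
    where open ≡-Reasoning

blowUp-≅ : {S : Graph k} {T : Graph l} {P : Graph c} {Q : Graph d}
  {κ : Fin k → Fin c} {μ : Fin l → Fin d} → IsBlowUp S κ P → IsBlowUp T μ Q →
  (σ : Fin k → Fin l) (σ⁻¹ : Fin l → Fin k) →
  (∀ x → σ⁻¹ (σ x) ≡ x) → (∀ y → σ (σ⁻¹ y) ≡ y) →
  (τ : Fin c → Fin d) → (∀ x → μ (σ x) ≡ τ (κ x)) →
  (∀ u v → reflAdj Q (τ u) (τ v) ≡ reflAdj P u v) →
  S ≅ T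
blowUp-≅ S-blowUp T-blowUp σ σ⁻¹ σ⁻¹σ σσ⁻¹ τ μσ≡τκ τ-pattern =
  iso (blowUp-embeds S-blowUp T-blowUp σ σ-inj τ μσ≡τκ τ-pattern) λ y → σ⁻¹ y , σσ⁻¹ y
  where
  σ-inj : Injective _≡_ _≡_ σ
  σ-inj {x} {y} e = trans (sym (σ⁻¹σ x)) (trans (cong σ⁻¹ e) (σ⁻¹σ y))

self-isBlowUp : (P : Graph k) → IsBlowUp P id P
self-isBlowUp P = blowUp λ {x} {y} x≢y → cong (_∨ adj P x y) (sym (⌊≟⌋-≢ x≢y))

extend-isBlowUp : {S : Graph k} {P : Graph c} {κ : Fin k → Fin c} {b : Fin k → Bool}
  {β : Fin c → Bool} → IsBlowUp S κ P →
  (∀ x → b x ≡ β (κ x)) → IsBlowUp (extend S b) (lift 1 κ) (extend P β)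
extend-isBlowUp {κ = κ} (blowUp S-blowUp) b≡βκ = blowUp adj⁺-blowUp
  where
  adj⁺-blowUp : ∀ {x y} → x ≢ y → _
  adj⁺-blowUp {zero}  {zero}  0≢0 = ⊥-elim (0≢0 refl)
  adj⁺-blowUp {zero}  {suc y} _   = b≡βκ y
  adj⁺-blowUp {suc x} {zero}  _   = b≡βκ x
  adj⁺-blowUp {suc x} {suc y} x≢y =
    trans (S-blowUp (x≢y ∘ cong suc)) (cong (_∨ _) (sym (⌊⌋-map′ (cong suc) suc-injective (κ x ≟ κ y))))

module _ (H : Graph (suc n)) where

  private
    inClique? : Fin n ⊎ Fin (suc m) → Bool
    inClique? = [ const false , const true ]′

    colour : Fin n ⊎ Fin (suc m) → Fin (suc n)
    colour = [ inject₁ , const (fromℕ n) ]′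

    code≡colour : (x : Fin (n + suc m)) → code x ≡ colour (splitAt n x)
    code≡colour x with splitAt n x
    ... | inj₁ _ = refl
    ... | inj₂ _ = refl

    inClique≡inClique? : (x : Fin (n + suc m)) → inClique x ≡ inClique? (splitAt n x)
    inClique≡inClique? x with splitAt n x
    ... | inj₁ _ = refl
    ... | inj₂ _ = refl

    splitAt-injective : {x y : Fin (n + suc m)} → splitAt n x ≡ splitAt n y → x ≡ y
    splitAt-injective {m = m} {x} {y} e =
      trans (sym (join-splitAt n (suc m) x)) (trans (cong (join n (suc m)) e) (join-splitAt n (suc m) y))

    link : Fin n ⊎ Fin (suc m) → Fin n ⊎ Fin (suc m) → Bool
    link s t = (inClique? s ∧ inClique? t) ∨ adj H (colour s) (colour t)

    adj-∨-sym : ∀ u v → adj H u v ∨ adj H v u ≡ adj H u v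
    adj-∨-sym u v = trans (cong (adj H u v ∨_) (adj-sym H v u)) (∨-idem _)

    link-sym : (s t : Fin n ⊎ Fin (suc m)) → s ≢ t →
      link s t ∨ link t s ≡ reflAdj H (colour s) (colour t)
    link-sym (inj₁ i) (inj₁ j) s≢t = trans (adj-∨-sym _ _)
      (cong (_∨ adj H (inject₁ i) (inject₁ j)) (sym (⌊≟⌋-≢ (s≢t ∘ cong inj₁ ∘ inject₁-injective))))
    link-sym (inj₁ i) (inj₂ j) _ = trans (adj-∨-sym _ _)
      (cong (_∨ adj H (inject₁ i) (fromℕ n)) (sym (⌊≟⌋-≢ (fromℕ≢inject₁ ∘ sym))))
    link-sym (inj₂ i) (inj₁ j) _ = trans (adj-∨-sym _ _)
      (cong (_∨ adj H (fromℕ n) (inject₁ j)) (sym (⌊≟⌋-≢ fromℕ≢inject₁)))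
    link-sym (inj₂ i) (inj₂ j) _ = cong (_∨ adj H (fromℕ n) (fromℕ n)) (sym (⌊≟⌋-refl (fromℕ n)))

  expandLast-isBlowUp : (m : ℕ) → IsBlowUp (expandLast H m) code H
  expandLast-isBlowUp m = blowUp λ {x} {y} x≢y → expandLast-adj x y x≢y
    where
    r : Fin (n + suc m) → Fin (n + suc m) → Bool
    r x y = (inClique x ∧ inClique y) ∨ adj H (code x) (code y)

    r≡link : ∀ x y → r x y ≡ link (splitAt n x) (splitAt n y)
    r≡link x y = cong₂ _∨_ (cong₂ _∧_ (inClique≡inClique? x) (inClique≡inClique? y))
                           (cong₂ (adj H) (code≡colour x) (code≡colour y))

    expandLast-adj : ∀ x y → x ≢ y → adj (expandLast H m) x y ≡ reflAdj H (code x) (code y)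
    expandLast-adj x y x≢y = begin
      not ⌊ x ≟ y ⌋ ∧ (r x y ∨ r y x)
        ≡⟨ cong (λ b → not b ∧ (r x y ∨ r y x)) (⌊≟⌋-≢ x≢y) ⟩
      r x y ∨ r y x
        ≡⟨ cong₂ _∨_ (r≡link x y) (r≡link y x) ⟩
      link (splitAt n x) (splitAt n y) ∨ link (splitAt n y) (splitAt n x)
        ≡⟨ link-sym _ _ (x≢y ∘ splitAt-injective) ⟩
      reflAdj H (colour (splitAt n x)) (colour (splitAt n y))
        ≡⟨ sym (cong₂ (reflAdj H) (code≡colour x) (code≡colour y)) ⟩
      reflAdj H (code x) (code y) ∎
        where open ≡-Reasoning

  module _ {m m′ : ℕ} (ρ : Fin (suc m′) → Fin (suc m)) where

    widen : Fin (n + suc m′) → Fin (n + suc m)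
    widen = join n (suc m) ∘ Sum.map₂ ρ ∘ splitAt n

    code-widen : ∀ x → code (widen x) ≡ code x
    code-widen x = begin
      code (widen x)                                       ≡⟨ code≡colour (widen x) ⟩
      colour (splitAt n (join n (suc m) (Sum.map₂ ρ s)))   ≡⟨ cong colour (splitAt-join n (suc m) (Sum.map₂ ρ s)) ⟩
      colour (Sum.map₂ ρ s)                                ≡⟨ colour-map₂ s ⟩
      colour s                                             ≡⟨ sym (code≡colour x) ⟩
      code x                                               ∎
      where
      open ≡-Reasoning
      s = splitAt n x
      colour-map₂ : ∀ s → colour (Sum.map₂ ρ s) ≡ colour s
      colour-map₂ (inj₁ _) = refl
      colour-map₂ (inj₂ _) = refl

    widen-injective : Injective _≡_ _≡_ ρ → Injective _≡_ _≡_ widen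
    widen-injective ρ-inj {x} {y} e = splitAt-injective (map₂-injective
      (trans (sym (splitAt-join n (suc m) _)) (trans (cong (splitAt n) e) (splitAt-join n (suc m) _))))
      where
      map₂-injective : ∀ {s t : Fin n ⊎ Fin (suc m′)} → Sum.map₂ ρ s ≡ Sum.map₂ ρ t → s ≡ t
      map₂-injective {inj₁ _} {inj₁ _} refl = refl
      map₂-injective {inj₂ _} {inj₂ _} e    = cong inj₂ (ρ-inj (inj₂-injective e))

    expandLast-mono : Injective _≡_ _≡_ ρ → Embeds (expandLast H m′) (expandLast H m)
    expandLast-mono ρ-inj = blowUp-embeds (expandLast-isBlowUp m′) (expandLast-isBlowUp m)
      widen (widen-injective ρ-inj) id code-widen (λ _ _ → refl)

-- How a vertex outside H₃(C) can attach to it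

pattern u₁ = zero
pattern u₂ = suc u₁
pattern u₃ = suc u₂
pattern u₄ = suc u₃
pattern u₅ = suc u₄
pattern cl j = suc (suc (suc (suc (suc j))))

pattern v0 = zero
pattern v1 = suc v0
pattern v2 = suc v1
pattern v3 = suc v2
pattern v4 = suc v3
pattern v5 = suc v4
pattern v6 = suc v5
pattern v7 = suc v6

data Obstructed (S : Graph k) : Set where
  hasClaw : Embeds K13 S → Obstructed S
  hasZ2   : Embeds Z2 S → Obstructed S

Obstructed-map : {S : Graph k} {T : Graph l} → Embeds S T → Obstructed S → Obstructed T
Obstructed-map {S = S} {T} e (hasClaw f) = hasClaw (Embeds-trans {F = K13} {S} {T} f e)
Obstructed-map {S = S} {T} e (hasZ2 f)   = hasZ2 (Embeds-trans {F = Z2} {S} {T} f e)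

free⇒unobstructed : {G : Graph n} → Free K13 G → Free Z2 G → ¬ Obstructed G
free⇒unobstructed k13 z2 (hasClaw e) = k13 e
free⇒unobstructed k13 z2 (hasZ2 e)   = z2 e

data Attachment : Set where
  twin opposite side₂ side₃ detached : Attachment

data IsSide : Attachment → Set where
  isSide₂ : IsSide side₂
  isSide₃ : IsSide side₃

-- Adjacency to u₁, …, u₅ and to the clique C.
profile : Attachment → Vec Bool 6
profile twin     = false ∷ true  ∷ true  ∷ true  ∷ true  ∷ true  ∷ []
profile opposite = false ∷ false ∷ false ∷ true  ∷ true  ∷ false ∷ []
profile side₂    = true  ∷ true  ∷ false ∷ false ∷ true  ∷ false ∷ []
profile side₃    = true  ∷ false ∷ true  ∷ true  ∷ false ∷ false ∷ []
profile detached = false ∷ false ∷ false ∷ false ∷ false ∷ false ∷ []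

init-profile-injective : ∀ {t t′} → init (profile t) ≡ init (profile t′) → t ≡ t′
init-profile-injective {t} {t′} e = trans (sym (decode-profile t)) (trans (cong decode e) (decode-profile t′))
  where
  decode : Vec Bool 5 → Attachment
  decode (false ∷ true  ∷ true  ∷ true  ∷ true  ∷ []) = twin
  decode (false ∷ false ∷ false ∷ true  ∷ true  ∷ []) = opposite
  decode (true  ∷ true  ∷ false ∷ false ∷ true  ∷ []) = side₂
  decode (true  ∷ false ∷ true  ∷ true  ∷ false ∷ []) = side₃
  decode _                                            = detached

  decode-profile : ∀ t → decode (init (profile t)) ≡ t
  decode-profile twin     = refl
  decode-profile opposite = refl
  decode-profile side₂    = refl
  decode-profile side₃    = refl
  decode-profile detached = refl

Attaches : (Fin (5 + suc m) → Bool) → Attachment → Set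
Attaches b t = ∀ x → b x ≡ lookup (profile t) (code x)

-- Vertex 0 is the new vertex, vertex i is uᵢ and vertex 6 is the single clique vertex.
configuration : Vec Bool 6 → Graph 7
configuration p = extend (H3exp 0) (lookup p)

configuration-classification : ∀ p → Obstructed (configuration p) ⊎ ∃ λ t → p ≡ profile t
configuration-classification = allVecs-just 6 classify _
  where
  claws : List (Vec (Fin 7) 4)
  claws = (v3 ∷ v1 ∷ v0 ∷ v6 ∷ []) ∷ (v0 ∷ v4 ∷ v5 ∷ v1 ∷ []) ∷ (v6 ∷ v4 ∷ v0 ∷ v5 ∷ []) ∷
          (v1 ∷ v2 ∷ v0 ∷ v3 ∷ []) ∷ (v2 ∷ v6 ∷ v1 ∷ v0 ∷ []) ∷ (v6 ∷ v4 ∷ v0 ∷ v3 ∷ []) ∷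
          (v6 ∷ v5 ∷ v2 ∷ v0 ∷ []) ∷ []

  z2s : List (Vec (Fin 7) 5)
  z2s = (v2 ∷ v1 ∷ v0 ∷ v6 ∷ v5 ∷ []) ∷ (v6 ∷ v0 ∷ v4 ∷ v3 ∷ v1 ∷ []) ∷ (v0 ∷ v5 ∷ v3 ∷ v2 ∷ v4 ∷ []) ∷
        (v1 ∷ v3 ∷ v0 ∷ v2 ∷ v4 ∷ []) ∷ (v3 ∷ v0 ∷ v5 ∷ v1 ∷ v2 ∷ []) ∷ (v0 ∷ v2 ∷ v4 ∷ v3 ∷ v5 ∷ []) ∷
        (v6 ∷ v2 ∷ v4 ∷ v5 ∷ v0 ∷ []) ∷ (v1 ∷ v0 ∷ v2 ∷ v3 ∷ v5 ∷ []) ∷ (v6 ∷ v5 ∷ v3 ∷ v4 ∷ v0 ∷ []) ∷ []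

  recognise : (p : Vec Bool 6) → List Attachment → Maybe (∃ λ t → p ≡ profile t)
  recognise p [] = nothing
  recognise p (t ∷ ts) with Vec.≡-dec Bool._≟_ p (profile t)
  ... | yes e = just (t , e)
  ... | no _  = recognise p ts

  classify : (p : Vec Bool 6) → Maybe (Obstructed (configuration p) ⊎ ∃ λ t → p ≡ profile t)
  classify p = Maybe.map inj₂ (recognise p (twin ∷ opposite ∷ side₂ ∷ side₃ ∷ detached ∷ []))
           <∣> Maybe.map (inj₁ ∘ hasClaw) (findEmbedding K13 (configuration p) claws)
           <∣> Maybe.map (inj₁ ∘ hasZ2) (findEmbedding Z2 (configuration p) z2s)

Z2-at : {S : Graph k} (w : Vec (Fin k) 5) → {True (isInduced? Z2 S (lookup w))} → Obstructed S
Z2-at w {w-ok} = hasZ2 (lookup w , toWitness w-ok)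

-- With two clique vertices c, c′ (vertices 6 and 7), for side₂ (resp. side₃) u₃ c c′
-- (resp. u₂ c c′) is a triangle and u₃ u₁ a (resp. u₂ u₁ a) an induced path hanging from it.
side-obstructed : ∀ {t} → IsSide t → Obstructed (extend (H3exp 1) (lookup (profile t) ∘ code))
side-obstructed isSide₂ = Z2-at (v3 ∷ v6 ∷ v7 ∷ v1 ∷ v0 ∷ [])
side-obstructed isSide₃ = Z2-at (v2 ∷ v6 ∷ v7 ∷ v1 ∷ v0 ∷ [])

-- The graphs G[V(H) ∪ {a}] for the admissible attachments

by-evaluation₂ : {P : Fin k → Fin l → Set} (P? : ∀ u v → Dec (P u v)) →
  {True (all? λ u → all? (P? u))} → ∀ u v → P u v
by-evaluation₂ P? {t} = toWitness t

twin-extension : {b : Fin (5 + suc m) → Bool} → Attaches b twin → extend (H3exp m) b ≅ H3exp (suc m)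
twin-extension {m} att =
  blowUp-≅ (extend-isBlowUp (expandLast-isBlowUp H3 m) att) (expandLast-isBlowUp H3 (suc m))
    σ σ⁻¹ σ⁻¹σ σσ⁻¹ τ code-σ
    (by-evaluation₂ λ u v → reflAdj H3 (τ u) (τ v) Bool.≟ reflAdj (extend H3 (lookup (profile twin))) u v)
  where
  σ : Fin (suc (5 + suc m)) → Fin (5 + suc (suc m))
  σ zero         = cl zero
  σ (suc u₁)     = u₁
  σ (suc u₂)     = u₂
  σ (suc u₃)     = u₃
  σ (suc u₄)     = u₄
  σ (suc u₅)     = u₅
  σ (suc (cl j)) = cl (suc j)

  σ⁻¹ : Fin (5 + suc (suc m)) → Fin (suc (5 + suc m))
  σ⁻¹ u₁           = suc u₁
  σ⁻¹ u₂           = suc u₂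
  σ⁻¹ u₃           = suc u₃
  σ⁻¹ u₄           = suc u₄
  σ⁻¹ u₅           = suc u₅
  σ⁻¹ (cl zero)    = zero
  σ⁻¹ (cl (suc j)) = suc (cl j)

  σ⁻¹σ : ∀ x → σ⁻¹ (σ x) ≡ x
  σ⁻¹σ zero         = refl
  σ⁻¹σ (suc u₁)     = refl
  σ⁻¹σ (suc u₂)     = refl
  σ⁻¹σ (suc u₃)     = refl
  σ⁻¹σ (suc u₄)     = refl
  σ⁻¹σ (suc u₅)     = refl
  σ⁻¹σ (suc (cl j)) = refl

  σσ⁻¹ : ∀ y → σ (σ⁻¹ y) ≡ y
  σσ⁻¹ u₁           = refl
  σσ⁻¹ u₂           = refl
  σσ⁻¹ u₃           = refl
  σσ⁻¹ u₄           = refl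
  σσ⁻¹ u₅           = refl
  σσ⁻¹ (cl zero)    = refl
  σσ⁻¹ (cl (suc j)) = refl

  τ : Fin 7 → Fin 6
  τ zero    = cl zero
  τ (suc c) = c

  code-σ : ∀ x → code (σ x) ≡ τ (lift 1 code x)
  code-σ zero         = refl
  code-σ (suc u₁)     = refl
  code-σ (suc u₂)     = refl
  code-σ (suc u₃)     = refl
  code-σ (suc u₄)     = refl
  code-σ (suc u₅)     = refl
  code-σ (suc (cl j)) = refl

-- H₅ is H₃ plus a new vertex adjacent to u₄ and u₅, listed in the order u₁ a u₂ u₄ u₃ u₅.
opposite-extension : {b : Fin (5 + suc m) → Bool} → Attaches b opposite → extend (H3exp m) b ≅ H5exp m
opposite-extension {m} att =
  blowUp-≅ (extend-isBlowUp (expandLast-isBlowUp H3 m) att) (expandLast-isBlowUp H5 m)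
    relabel relabel relabel-involutive relabel-involutive relabel code-relabel
    (by-evaluation₂ λ u v → reflAdj H5 (relabel u) (relabel v) Bool.≟ reflAdj (extend H3 (lookup (profile opposite))) u v)
  where
  relabel : Fin (6 + l) → Fin (6 + l)
  relabel v0            = v1
  relabel v1            = v0
  relabel v2            = v2
  relabel v3            = v4
  relabel v4            = v3
  relabel v5            = v5
  relabel (suc (cl j))  = suc (cl j)

  relabel-involutive : ∀ x → relabel {l} (relabel x) ≡ x
  relabel-involutive v0           = refl
  relabel-involutive v1           = refl
  relabel-involutive v2           = refl
  relabel-involutive v3           = refl
  relabel-involutive v4           = refl
  relabel-involutive v5           = refl
  relabel-involutive (suc (cl j)) = refl

  code-relabel : ∀ x → code (relabel x) ≡ relabel (lift 1 code x)
  code-relabel v0           = refl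
  code-relabel v1           = refl
  code-relabel v2           = refl
  code-relabel v3           = refl
  code-relabel v4           = refl
  code-relabel v5           = refl
  code-relabel (suc (cl j)) = refl

H6-by-relabelling : ∀ t {b : Fin 6 → Bool} → Attaches b t → (σ σ⁻¹ : Vec (Fin 7) 7) →
  {True (all? λ x → lookup σ⁻¹ (lookup σ x) ≟ x)} →
  {True (all? λ y → lookup σ (lookup σ⁻¹ y) ≟ y)} →
  {True (all? λ x → lookup σ x ≟ lookup σ (lift 1 code x))} →
  {True (all? λ u → all? λ v →
     reflAdj H6 (lookup σ u) (lookup σ v) Bool.≟ reflAdj (extend H3 (lookup (profile t))) u v)} →
  extend (H3exp 0) b ≅ H6
H6-by-relabelling t att σ σ⁻¹ {σ⁻¹σ} {σσ⁻¹} {commutes} {pattern-ok} =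
  blowUp-≅ (extend-isBlowUp (expandLast-isBlowUp H3 0) att) (self-isBlowUp H6)
    (lookup σ) (lookup σ⁻¹) (toWitness σ⁻¹σ) (toWitness σσ⁻¹)
    (lookup σ) (toWitness commutes) (toWitness pattern-ok)

-- In the second table, x₁ … x₇ of H₆ are u₁ u₃ a u₅ u₂ c u₄ (side₂), resp. u₁ u₂ a u₄ u₃ c u₅ (side₃).
side-extension : ∀ {t} → IsSide t → m ≡ 0 → {b : Fin (5 + suc m) → Bool} → Attaches b t → extend (H3exp m) b ≅ H6
side-extension isSide₂ refl att = H6-by-relabelling side₂ att
  (v2 ∷ v0 ∷ v4 ∷ v1 ∷ v6 ∷ v3 ∷ v5 ∷ []) (v1 ∷ v3 ∷ v0 ∷ v5 ∷ v2 ∷ v6 ∷ v4 ∷ [])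
side-extension isSide₃ refl att = H6-by-relabelling side₃ att
  (v2 ∷ v0 ∷ v1 ∷ v4 ∷ v3 ∷ v6 ∷ v5 ∷ []) (v1 ∷ v2 ∷ v0 ∷ v4 ∷ v3 ∷ v6 ∷ v5 ∷ [])

NeighboursAre : (Fin k → Bool) → (Fin k → Set) → Set
NeighboursAre b P = ∀ x → (b x ≡ true → P x) × (P x → b x ≡ true)

private
  present : ∀ {β} {P : Set} → β ≡ true → P → (β ≡ true → P) × (P → β ≡ true)
  present β≡true p = const p , const β≡true

  absent : ∀ {β} {P : Set} → β ≡ false → ¬ P → (β ≡ true → P) × (P → β ≡ true)
  absent β≡false ¬p = (λ β≡true → contradiction (trans (sym β≡false) β≡true) λ ()) , ⊥-elim ∘ ¬p

opposite-neighbours : {b : Fin (5 + suc m) → Bool} → Attaches b opposite →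
  NeighboursAre b (λ x → IsU 4 x ⊎ IsU 5 x)
opposite-neighbours att u₁     = absent  (att u₁) λ { (inj₁ ()) ; (inj₂ ()) }
opposite-neighbours att u₂     = absent  (att u₂) λ { (inj₁ ()) ; (inj₂ ()) }
opposite-neighbours att u₃     = absent  (att u₃) λ { (inj₁ ()) ; (inj₂ ()) }
opposite-neighbours att u₄     = present (att u₄) (inj₁ refl)
opposite-neighbours att u₅     = present (att u₅) (inj₂ refl)
opposite-neighbours att (cl j) = absent  (att (cl j)) λ { (inj₁ ()) ; (inj₂ ()) }

side₂-neighbours : {b : Fin (5 + suc m) → Bool} → Attaches b side₂ →
  NeighboursAre b (λ x → IsU 1 x ⊎ IsU 2 x ⊎ IsU (7 ∸ 2) x)
side₂-neighbours att u₁        = present (att u₁) (inj₁ refl)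
side₂-neighbours att u₂        = present (att u₂) (inj₂ (inj₁ refl))
side₂-neighbours att u₃        = absent  (att u₃) λ { (inj₁ ()) ; (inj₂ (inj₁ ())) ; (inj₂ (inj₂ ())) }
side₂-neighbours att u₄        = absent  (att u₄) λ { (inj₁ ()) ; (inj₂ (inj₁ ())) ; (inj₂ (inj₂ ())) }
side₂-neighbours att u₅        = present (att u₅) (inj₂ (inj₂ refl))
side₂-neighbours att (cl j)    = absent  (att (cl j)) λ { (inj₁ ()) ; (inj₂ (inj₁ ())) ; (inj₂ (inj₂ ())) }

side₃-neighbours : {b : Fin (5 + suc m) → Bool} → Attaches b side₃ →
  NeighboursAre b (λ x → IsU 1 x ⊎ IsU 3 x ⊎ IsU (7 ∸ 3) x)
side₃-neighbours att u₁        = present (att u₁) (inj₁ refl)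
side₃-neighbours att u₂        = absent  (att u₂) λ { (inj₁ ()) ; (inj₂ (inj₁ ())) ; (inj₂ (inj₂ ())) }
side₃-neighbours att u₃        = present (att u₃) (inj₂ (inj₁ refl))
side₃-neighbours att u₄        = present (att u₄) (inj₂ (inj₂ refl))
side₃-neighbours att u₅        = absent  (att u₅) λ { (inj₁ ()) ; (inj₂ (inj₁ ())) ; (inj₂ (inj₂ ())) }
side₃-neighbours att (cl j)    = absent  (att (cl j)) λ { (inj₁ ()) ; (inj₂ (inj₁ ())) ; (inj₂ (inj₂ ())) }

detached-isolated : {b : Fin (5 + suc m) → Bool} → Attaches b detached → ∀ x → b x ≡ false
detached-isolated att x = trans (att x) (lookup-replicate (code {5} x) false)

Fin-subsingleton⇒≡0 : (∀ (j k : Fin (suc m)) → j ≡ k) → m ≡ 0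
Fin-subsingleton⇒≡0 {zero}  _          = refl
Fin-subsingleton⇒≡0 {suc m} all-equal with all-equal zero (suc zero)
... | ()

Fin1-unique : (x y : Fin 1) → x ≡ y
Fin1-unique zero    zero    = refl
Fin1-unique zero    (suc ())
Fin1-unique (suc ()) _

module Attachments (G : Graph n) (k13 : Free K13 G) (z2 : Free Z2 G)
         (φ : Embeds (H3exp m) G) (a : Fin n) (a∉φ : ¬ (∃ λ x → proj₁ φ x ≡ a)) where

  nbr : Fin (5 + suc m) → Bool
  nbr x = adj G a (proj₁ φ x)

  induced-copy : {T : Graph l} → extend (H3exp m) nbr ≅ T → InducesCopy T G (ImgPlus (proj₁ φ) a)
  induced-copy S≅T = InducesCopy-resp-≅ {G = G} S≅T (adjoin {G = G} φ a a∉φ)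

  private

    unobstructed : {S : Graph k} {β : Fin k → Bool} (ψ : Embeds S (H3exp m)) →
      (∀ x → β x ≡ nbr (proj₁ ψ x)) → ¬ Obstructed (extend S β)
    unobstructed {S = S} {β} ψ β≗nbrψ = free⇒unobstructed {G = G} k13 z2 ∘ Obstructed-map {T = G} extension↪G
      where
      extension↪G : Embeds (extend S β) G
      extension↪G = Embeds-trans {F = extend S β} {H = extend S (nbr ∘ proj₁ ψ)} {G = G}
        (extend-cong β≗nbrψ)
        (proj₁ (adjoin {G = G} (Embeds-trans {F = S} {H = H3exp m} {G = G} ψ φ) a
                               λ (x , e) → a∉φ (proj₁ ψ x , e)))

    local-profile : (j : Fin (suc m)) → ∃ λ t → tabulate (nbr ∘ widen H3 (const j)) ≡ profile t
    local-profile j = [ ⊥-elim ∘ unobstructed (expandLast-mono H3 (const j) λ {x} {y} _ → Fin1-unique x y)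
                                             (lookup∘tabulate (nbr ∘ widen H3 (const j)))
                     , id ]′ (configuration-classification _)

  attachment : ∃ (Attaches nbr)
  attachment = t₀ , attaches
    where
    t₀ : Attachment
    t₀ = proj₁ (local-profile zero)

    same-profile : ∀ j → proj₁ (local-profile j) ≡ t₀
    same-profile j = init-profile-injective
      (trans (sym (cong init (proj₂ (local-profile j)))) (cong init (proj₂ (local-profile zero))))

    local : ∀ j i → nbr (widen H3 (const j) i) ≡ lookup (profile (proj₁ (local-profile j))) i
    local j i = trans (sym (lookup∘tabulate (nbr ∘ widen H3 (const j)) i))
                      (cong (λ v → lookup v i) (proj₂ (local-profile j)))

    attaches : Attaches nbr t₀
    attaches u₁     = local zero u₁
    attaches u₂     = local zero u₂
    attaches u₃     = local zero u₃
    attaches u₄     = local zero u₄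
    attaches u₅     = local zero u₅
    attaches (cl j) = trans (local j (cl zero)) (cong (λ t → lookup (profile t) (cl zero)) (same-profile j))

  sides-forbid-two-clique-vertices : ∀ {t} → Attaches nbr t → IsSide t → {j k : Fin (suc m)} → j ≢ k → ⊥
  sides-forbid-two-clique-vertices {t} att side {j} {k} j≢k =
    unobstructed (expandLast-mono H3 pair pair-injective) β≗nbr (side-obstructed side)
    where
    pair : Fin 2 → Fin (suc m)
    pair zero       = j
    pair (suc zero) = k

    pair-injective : Injective _≡_ _≡_ pair
    pair-injective {zero}     {zero}     _ = refl
    pair-injective {zero}     {suc zero} e = ⊥-elim (j≢k e)
    pair-injective {suc zero} {zero}     e = ⊥-elim (j≢k (sym e))
    pair-injective {suc zero} {suc zero} _ = refl

    β≗nbr : ∀ x → lookup (profile t) (code x) ≡ nbr (widen H3 pair x)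
    β≗nbr x = sym (trans (att (widen H3 pair x)) (cong (lookup (profile t)) (code-widen H3 pair x)))

  side-single-clique : ∀ {t} → Attaches nbr t → IsSide t → m ≡ 0
  side-single-clique att side =
    Fin-subsingleton⇒≡0 λ j k → decidable-stable (j ≟ k) (sides-forbid-two-clique-vertices att side)

lemma2p4 : ∀ {n} (G : Graph n) → Connected G →
    Free K13 G → Free Z2 G → Free Net G →
    (m : ℕ) (φ : Embeds (H3exp m) G) (a : Fin n) →
    ¬ (∃ λ x → proj₁ φ x ≡ a) →
    (∃ λ x → adj G a (proj₁ φ x) ≡ true) →
    In𝓗3 G (ImgPlus (proj₁ φ) a)
    ⊎ (∃ λ i → (i ≡ 2 ⊎ i ≡ 3) ×
         NbrInImgIs G (proj₁ φ) a (λ x → IsU 1 x ⊎ IsU i x ⊎ IsU (7 ∸ i) x) ×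
         m ≡ 0 × In𝓗6 G (ImgPlus (proj₁ φ) a))
    ⊎ (NbrInImgIs G (proj₁ φ) a (λ x → IsU 4 x ⊎ IsU 5 x) ×
         In𝓗5 G (ImgPlus (proj₁ φ) a))
lemma2p4 G _ k13 z2 _ m φ a a∉φ (x , ax) = case attachment of λ where
    (twin , att)     → inj₁ (suc m , induced-copy (twin-extension att))
    (opposite , att) → inj₂ (inj₂ (opposite-neighbours att , m , induced-copy (opposite-extension att)))
    (side₂ , att)    → inj₂ (inj₁ (2 , inj₁ refl , side₂-neighbours att , side-single-clique att isSide₂ ,
                                   induced-copy (side-extension isSide₂ (side-single-clique att isSide₂) att)))
    (side₃ , att)    → inj₂ (inj₁ (3 , inj₂ refl , side₃-neighbours att , side-single-clique att isSide₃ ,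
                                   induced-copy (side-extension isSide₃ (side-single-clique att isSide₃) att)))
    (detached , att) → contradiction (trans (sym ax) (detached-isolated att x)) λ ()
  where open Attachments G k13 z2 φ a a∉φ
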